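{- Let $p\in\mathrm{OFS}(\mathbb{Z}^+)$ with $p_1\ne\gcd(p)$. Then $fw(p)\ge 2p_1$.
   Context: $\mathrm{OFS}(\mathbb{Z}^+)$ denotes the set of all nonempty strictly increasing finite sequences of positive integers. For $p\in\mathrm{OFS}(\mathbb{Z}^+)$, $|p|$ is its length, $p_i$ its $i$-th entry, $p|_i=(p_1,\ldots,p_i)$, $\gcd(p)$ the gcd of its entries, $\max(p)=p_{|p|}$. The map $R$: $R(p)=p$ if $|p|=1$; if $n=|p|>1$, form $(p_2-p_1,\ldots,p_n-p_1)$ and, if $p_1$ does not appear in it, insert $p_1$ so that the result is strictly increasing. $f$ is defined recursively by $f(p)=p_1$ if $|p|=1$ and $f(p)=p_1+f(R(p))$ if $|p|>1$. $fw$ is defined by: if $n=|p|>1$, $\gcd(p|_{n-1})=\gcd(p)$ and $\max(p)\ge f(p|_{n-1})$, then $fw(p)=fw(p|_{n-1})$; otherwise $fw(p)=f(p)$. -}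

module Defs where

open import Data.Nat using (ℕ; zero; suc; _+_; _∸_; _<_; _≤_; _<ᵇ_; _≡ᵇ_; _≤ᵇ_)
open import Data.Nat.GCD using (gcd)
open import Data.List using (List; []; _∷_; map; take; length; foldr)
open import Data.Bool using (Bool; true; false; if_then_else_; _∧_)

gcdL : List ℕ → ℕ
gcdL = foldr gcd 0

-- max(p) = p_{|p|}, the last entry (junk value 0 on the empty list)
lastL : List ℕ → ℕ
lastL [] = 0
lastL (x ∷ []) = x
lastL (x ∷ y ∷ ys) = lastL (y ∷ ys)

insertIfAbsent : ℕ → List ℕ → List ℕ
insertIfAbsent x [] = x ∷ []
insertIfAbsent x (y ∷ ys) =
  if x <ᵇ y then x ∷ y ∷ ys
  else if x ≡ᵇ y then y ∷ ys
  else y ∷ insertIfAbsent x ys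

R : List ℕ → List ℕ
R [] = []
R (x ∷ []) = x ∷ []
R (x ∷ y ∷ ys) = insertIfAbsent x (map (λ z → z ∸ x) (y ∷ ys))

-- f with explicit fuel; each R-step on a valid sequence of length > 1
-- strictly decreases max, so fuel  1 + max p  suffices for p ∈ OFS(Z+)
fFuel : ℕ → List ℕ → ℕ
fFuel zero p = 0
fFuel (suc k) [] = 0
fFuel (suc k) (x ∷ []) = x
fFuel (suc k) (x ∷ y ∷ ys) = x + fFuel k (R (x ∷ y ∷ ys))

f : List ℕ → ℕ
f p = fFuel (suc (lastL p)) p

-- fwPre n p = fw (p|_n)
fwPre : ℕ → List ℕ → ℕ
fwPre zero p = 0
fwPre (suc zero) p = f (take 1 p)
fwPre (suc (suc m)) p =
  if (gcdL (take (suc m) p) ≡ᵇ gcdL (take (suc (suc m)) p))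
     ∧ (f (take (suc m) p) ≤ᵇ lastL (take (suc (suc m)) p))
  then fwPre (suc m) p
  else f (take (suc (suc m)) p)

fw : List ℕ → ℕ
fw p = fwPre (length p) p

-- Two facts drive the proof.
--  (a) f dominates its argument: every entry z of p satisfies z ≤ f(p).
--      Indeed f(p) = p₁ + f(R p); an entry z > p₁ of p reappears in R p
--      as z - p₁, and by induction z - p₁ ≤ f(R p).  Since Defs computes
--      f with fuel, the induction runs over the invariant "positive,
--      strictly increasing, all entries < k" (BoundedOFS k), which R
--      carries from bound 1 + k to bound k.
--      Consequently, if |p| ≥ 2 then p₁ ∈ R p, so f(p) ≥ p₁ + p₁ = 2p₁.
--  (b) Unfolding fw along the prefixes p|ₙ, p|ₙ₋₁, …: at each step either
--      fw(p|ₘ) = f(p|ₘ) with m ≥ 2, which is ≥ 2x by (a), or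
--      gcd(p|ₘ₋₁) = gcd(p|ₘ) and we descend.  If we reach p|₁, then all
--      the gcds agree and gcd(p) = gcd(p|₁) = x, contradicting x ≠ gcd(p).
module Submission where

open import Defs
open import Data.Nat using (ℕ; _<_; _≤_; _*_)
open import Data.List using (List; _∷_)
open import Data.List.Relation.Unary.All using (All)
open import Data.List.Relation.Unary.Linked using (Linked)
open import Relation.Binary.PropositionalEquality using (_≢_)

open import Data.Nat using (suc; _+_; _∸_; _≡ᵇ_; _≤ᵇ_; _<ᵇ_)
open import Data.Nat.Properties
open import Data.Nat.GCD using (gcd-identityʳ)
open import Data.List using ([]; map; take; length)
open import Data.List.Properties using (take-all)
open import Data.List.Relation.Unary.All using ([]; _∷_)
import Data.List.Relation.Unary.All as All
import Data.List.Relation.Unary.All.Properties as All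
open import Data.List.Relation.Unary.Linked using ([]; [-]; _∷_)
import Data.List.Relation.Unary.Linked as Linked
import Data.List.Relation.Unary.Linked.Properties as Linked
import Data.List.Relation.Unary.AllPairs.Properties as AllPairs
open import Data.List.Membership.Propositional using (_∈_)
open import Data.List.Membership.Propositional.Properties using (∈-map⁺)
open import Data.List.Relation.Unary.Any using (here; there)
open import Data.Bool using (true; false; T)
open import Data.Product using (_×_; _,_)
open import Data.Sum using (_⊎_; inj₁; inj₂)
open import Relation.Nullary using (contradiction)
open import Relation.Binary.PropositionalEquality
  using (_≡_; refl; sym; trans; cong; subst)

data InsertionView (x y : ℕ) (ys : List ℕ) : List ℕ → Set where
  before : x < y → InsertionView x y ys (x ∷ y ∷ ys)
  equal  : x ≡ y → InsertionView x y ys (y ∷ ys)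
  after  : y < x → InsertionView x y ys (y ∷ insertIfAbsent x ys)

insertion-view : ∀ x y ys → InsertionView x y ys (insertIfAbsent x (y ∷ ys))
insertion-view x y ys with x <ᵇ y in x<ᵇy
... | true = before (<ᵇ⇒< x y (subst T (sym x<ᵇy) _))
... | false with x ≡ᵇ y in x≡ᵇy
...   | true  = equal (≡ᵇ⇒≡ x y (subst T (sym x≡ᵇy) _))
...   | false = after (≤∧≢⇒< y≤x (λ y≡x → x≢y (sym y≡x)))
  where
  y≤x : y ≤ x
  y≤x = ≮⇒≥ (λ x<y → subst T x<ᵇy (<⇒<ᵇ x<y))
  x≢y : x ≢ y
  x≢y x≡y = subst T x≡ᵇy (≡⇒≡ᵇ x y x≡y)

insert-∈ : ∀ x l → x ∈ insertIfAbsent x l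
insert-∈ x [] = here refl
insert-∈ x (y ∷ ys) with insertIfAbsent x (y ∷ ys) | insertion-view x y ys
... | _ | before _   = here refl
... | _ | equal x≡y  = here x≡y
... | _ | after _    = there (insert-∈ x ys)

insert-keeps : ∀ {z} x l → z ∈ l → z ∈ insertIfAbsent x l
insert-keeps x (y ∷ ys) z∈l with insertIfAbsent x (y ∷ ys) | insertion-view x y ys
insert-keeps x (y ∷ ys) z∈l         | _ | before _ = there z∈l
insert-keeps x (y ∷ ys) z∈l         | _ | equal _  = z∈l
insert-keeps x (y ∷ ys) (here z≡y)  | _ | after _  = here z≡y
insert-keeps x (y ∷ ys) (there z∈l) | _ | after _  = there (insert-keeps x ys z∈l)

insert-All : ∀ {P : ℕ → Set} x l → P x → All P l → All P (insertIfAbsent x l)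
insert-All x [] px [] = px ∷ []
insert-All x (y ∷ ys) px (py ∷ pys) with insertIfAbsent x (y ∷ ys) | insertion-view x y ys
... | _ | before _ = px ∷ py ∷ pys
... | _ | equal _  = py ∷ pys
... | _ | after _  = py ∷ insert-All x ys px pys

insert-Linked-above : ∀ b x l → Linked _<_ (b ∷ l) → b < x →
                      Linked _<_ (b ∷ insertIfAbsent x l)
insert-Linked-above b x [] _ b<x = b<x ∷ [-]
insert-Linked-above b x (y ∷ ys) (b<y ∷ sorted) b<x
  with insertIfAbsent x (y ∷ ys) | insertion-view x y ys
... | _ | before x<y = b<x ∷ x<y ∷ sorted
... | _ | equal _    = b<y ∷ sorted
... | _ | after y<x  = b<y ∷ insert-Linked-above y x ys sorted y<x

insert-Linked : ∀ x l → Linked _<_ l → Linked _<_ (insertIfAbsent x l)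
insert-Linked x [] _ = [-]
insert-Linked x (y ∷ ys) sorted with insertIfAbsent x (y ∷ ys) | insertion-view x y ys
... | _ | before x<y = x<y ∷ sorted
... | _ | equal _    = sorted
... | _ | after y<x  = insert-Linked-above y x ys sorted y<x

-- Sequences in OFS(ℤ⁺) all of whose entries lie below k; fFuel k is the
-- honest value of f on them.
record BoundedOFS (k : ℕ) (p : List ℕ) : Set where
  field
    positive   : All (0 <_) p
    increasing : Linked _<_ p
    below      : All (_< k) p

∸-Linked : ∀ x l → Linked _<_ l → All (x <_) l → Linked _<_ (map (λ z → z ∸ x) l)
∸-Linked x [] _ _ = []
∸-Linked x (y ∷ []) _ _ = [-]
∸-Linked x (y ∷ z ∷ zs) (y<z ∷ sorted) (x<y ∷ x<zs) =
  ∸-monoˡ-< y<z (<⇒≤ x<y) ∷ ∸-Linked x (z ∷ zs) sorted x<zs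

R-BoundedOFS : ∀ k x y ys → BoundedOFS (suc k) (x ∷ y ∷ ys) →
               BoundedOFS k (R (x ∷ y ∷ ys))
R-BoundedOFS k x y ys p = record
  { positive   = insert-All x _ 0<x (All.map⁺ (All.map m<n⇒0<n∸m x<rest))
  ; increasing = insert-Linked x _ (∸-Linked x (y ∷ ys) (Linked.tail increasing) x<rest)
  ; below      = insert-All x _ x<k (All.map⁺ (All.zipWith difference<k (x<rest , All.tail below)))
  }
  where
  open BoundedOFS p
  0<x : 0 < x
  0<x = All.head positive
  x<rest : All (x <_) (y ∷ ys)
  x<rest = Linked.Linked⇒All <-trans (Linked.head increasing) (Linked.tail increasing)
  difference<k : ∀ {z} → x < z × z < suc k → z ∸ x < k
  difference<k {z} (x<z , z<1+k) = <-≤-trans (∸-monoʳ-< {z} {x} {0} 0<x (<⇒≤ x<z)) (≤-pred z<1+k)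
  x<k : x < k
  x<k = <-≤-trans (All.head x<rest) (≤-pred (All.head (All.tail below)))

entry≤fFuel : ∀ k p → BoundedOFS k p → ∀ {z} → z ∈ p → z ≤ fFuel k p
entry≤fFuel 0 p bounded z∈p = contradiction (All.lookup (BoundedOFS.below bounded) z∈p) n≮0
entry≤fFuel (suc k) (x ∷ []) _ (here refl) = ≤-refl
entry≤fFuel (suc k) (x ∷ y ∷ ys) _ (here refl) = m≤m+n x _
entry≤fFuel (suc k) (x ∷ y ∷ ys) bounded {z} (there z∈tail) = begin
  z                               ≤⟨ m≤n+m∸n z x ⟩
  x + (z ∸ x)                     ≤⟨ +-monoʳ-≤ x (entry≤fFuel k _ (R-BoundedOFS k x y ys bounded) z∸x∈Rp) ⟩
  fFuel (suc k) (x ∷ y ∷ ys)      ∎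
  where
  open ≤-Reasoning
  z∸x∈Rp : z ∸ x ∈ R (x ∷ y ∷ ys)
  z∸x∈Rp = insert-keeps x _ (∈-map⁺ (λ w → w ∸ x) z∈tail)

entries≤last : ∀ x l → Linked _<_ (x ∷ l) → All (_< suc (lastL (x ∷ l))) (x ∷ l)
entries≤last x [] _ = ≤-refl ∷ []
entries≤last x (y ∷ ys) (x<y ∷ sorted) with entries≤last y ys sorted
... | below@(y<bound ∷ _) = <-trans x<y y<bound ∷ below

-- For |p| ≥ 2, p₁ reappears in R p, hence f(p) = p₁ + f(R p) ≥ 2 p₁.
twice-head≤f : ∀ x y ys → All (0 <_) (x ∷ y ∷ ys) → Linked _<_ (x ∷ y ∷ ys) →
               2 * x ≤ f (x ∷ y ∷ ys)
twice-head≤f x y ys positive increasing = begin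
  2 * x                   ≡⟨ cong (x +_) (+-identityʳ x) ⟩
  x + x                   ≤⟨ +-monoʳ-≤ x (entry≤fFuel _ _ (R-BoundedOFS _ x y ys bounded) x∈Rp) ⟩
  f (x ∷ y ∷ ys)          ∎
  where
  open ≤-Reasoning
  bounded : BoundedOFS (suc (lastL (x ∷ y ∷ ys))) (x ∷ y ∷ ys)
  bounded = record { positive = positive ; increasing = increasing
                   ; below = entries≤last x (y ∷ ys) increasing }
  x∈Rp : x ∈ R (x ∷ y ∷ ys)
  x∈Rp = insert-∈ x (map (λ w → w ∸ x) (y ∷ ys))

take-Linked : ∀ n p → Linked _<_ p → Linked _<_ (take n p)
take-Linked n p increasing =
  Linked.AllPairs⇒Linked (AllPairs.take⁺ n (Linked.Linked⇒AllPairs <-trans increasing))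

fwPre-unfold : ∀ m p →
  fwPre (suc (suc m)) p ≡ f (take (suc (suc m)) p)
  ⊎ (gcdL (take (suc m) p) ≡ gcdL (take (suc (suc m)) p)
     × fwPre (suc (suc m)) p ≡ fwPre (suc m) p)
fwPre-unfold m p
  with gcdL (take (suc m) p) ≡ᵇ gcdL (take (suc (suc m)) p) in same-gcd
     | f (take (suc m) p) ≤ᵇ lastL (take (suc (suc m)) p)
... | false | _     = inj₁ refl
... | true  | false = inj₁ refl
... | true  | true  = inj₂ (≡ᵇ⇒≡ _ _ (subst T (sym same-gcd) _) , refl)

twice-head≤fw-or-gcd : ∀ x y ys → All (0 <_) (x ∷ y ∷ ys) → Linked _<_ (x ∷ y ∷ ys) →
  ∀ m → 2 * x ≤ fwPre (suc m) (x ∷ y ∷ ys) ⊎ gcdL (take (suc m) (x ∷ y ∷ ys)) ≡ x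
twice-head≤fw-or-gcd x y ys positive increasing 0 = inj₂ (gcd-identityʳ x)
twice-head≤fw-or-gcd x y ys positive increasing (suc m)
  with fwPre-unfold m (x ∷ y ∷ ys)
... | inj₁ fw≡f = inj₁ (subst (2 * x ≤_) (sym fw≡f)
        (twice-head≤f x y (take m ys) (All.take⁺ (suc (suc m)) positive)
                                      (take-Linked (suc (suc m)) _ increasing)))
... | inj₂ (same-gcd , fw≡fw)
  with twice-head≤fw-or-gcd x y ys positive increasing m
...   | inj₁ 2x≤fw = inj₁ (subst (2 * x ≤_) (sym fw≡fw) 2x≤fw)
...   | inj₂ gcd≡x = inj₂ (trans (sym same-gcd) gcd≡x)

proposition6 : (x : ℕ) (xs : List ℕ) → All (λ z → 0 < z) (x ∷ xs) → Linked _<_ (x ∷ xs)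
    → x ≢ gcdL (x ∷ xs) → 2 * x ≤ fw (x ∷ xs)
proposition6 x [] _ _ x≢gcd = contradiction (sym (gcd-identityʳ x)) x≢gcd
proposition6 x (y ∷ ys) positive increasing x≢gcd
  with twice-head≤fw-or-gcd x y ys positive increasing (length (y ∷ ys))
... | inj₁ 2x≤fw = 2x≤fw
... | inj₂ gcd≡x = contradiction (sym gcd[p]≡x) x≢gcd
  where
  gcd[p]≡x : gcdL (x ∷ y ∷ ys) ≡ x
  gcd[p]≡x = subst (λ q → gcdL q ≡ x) (take-all _ (x ∷ y ∷ ys) ≤-refl) gcd≡x
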